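{- For $x \in \mathbb{C}$ and $n\in\mathbb{N}_0$, $$\sum_{k=1}^n k^4 H_k(x) = \frac{6x^5 + 15x^4 + 10x^3 - x - n + 10n^3 + 15n^4 + 6n^5}{30} H_n(x) - \frac{(72n^4 - 45n^3 - 130n^2 + 75n + 28)n}{1800} - \frac{(12x^3 + 24x^2 + 7x - 6nx^2 - 9nx + 4n^2x - 5 + 2n + 4n^2 - 3n^3)nx}{60}.$$
   Context: For $x\in\mathbb{C}$ and $n\in\mathbb{N}_0$, $H_0(x)=0$ and $H_n(x)=\sum_{k=1}^n \frac{1}{x+k}$ for $n\ge 1$ (defined whenever $x$ is not one of $-1,\dots,-n$). -}

module Defs where

open import Level using (Level; _⊔_)
open import Data.Nat as ℕ using (ℕ; zero; suc)
open import Relation.Nullary using (¬_)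
open import Algebra.Bundles using (CommutativeRing)

ιᴿ : ∀ {c ℓ} (R : CommutativeRing c ℓ) → ℕ → CommutativeRing.Carrier R
ιᴿ R zero = CommutativeRing.0# R
ιᴿ R (suc n) = CommutativeRing._+_ R (CommutativeRing.1# R) (ιᴿ R n)

-- A field of characteristic zero (e.g. ℂ): a commutative ring together with a
-- total inverse operation (its value at 0 is junk and never used) which is a
-- genuine multiplicative inverse on every nonzero element, and such that no
-- positive integer n·1 is zero.
record CharZeroField (c ℓ : Level) : Set (Level.suc (c ⊔ ℓ)) where
  field
    commRing : CommutativeRing c ℓ
  open CommutativeRing commRing public
  field
    _⁻¹      : Carrier → Carrier
    ⁻¹-cong  : ∀ {x y} → x ≈ y → x ⁻¹ ≈ y ⁻¹
    inverseʳ : ∀ x → ¬ (x ≈ 0#) → x * x ⁻¹ ≈ 1#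
    char0    : ∀ n → ¬ (ιᴿ commRing (suc n) ≈ 0#)

  infix 8 _⁻¹

  ι : ℕ → Carrier
  ι = ιᴿ commRing

  Σ₁ : ℕ → (ℕ → Carrier) → Carrier
  Σ₁ zero f = 0#
  Σ₁ (suc n) f = Σ₁ n f + f (suc n)

  H : ℕ → Carrier → Carrier
  H n x = Σ₁ n (λ k → (x + ι k) ⁻¹)

  -- H_n(x) is defined: x is not one of -1, …, -n
  Admissible : ℕ → Carrier → Set ℓ
  Admissible n x = ∀ k → 1 ℕ.≤ k → k ℕ.≤ n → ¬ (x + ι k ≈ 0#)

  _^_ : Carrier → ℕ → Carrier
  x ^ zero = 1#
  x ^ suc n = x * (x ^ n)

module Submission where

-- The proof is summation by parts, organised as an induction on n.  Let F(N,h)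
-- denote the right-hand side with n ↦ N and H_n(x) ↦ h.  Then F(0,0) = 0, and
-- since H_{n+1}(x) = H_n(x) + u with u = 1/(x+n+1) it suffices to show
-- F(N+1,h+u) = F(N,h) + (N+1)⁴(h+u) whenever (x+N+1)u = 1.  This follows from
-- three identities of integer polynomials:
--   (i)   A(x,N+1) = A(x,N) + 30 (N+1)⁴,
--   (ii)  A(x,N) = (x+N+1) Q(x,N)            (A vanishes at N = −x−1),
--   (iii) ΔB(N) + 30 ΔC(x,N) = 60 Q(x,N),    where Δ is the forward difference in N,
-- so the extra term A(x,N)/30 · u collapses to Q/30 = ΔB/1800 + ΔC/60.

open import Defs
open import Data.Nat as ℕ using (ℕ; zero; suc)
import Data.Nat.Properties as ℕP
open import Data.Integer as ℤ using (ℤ; +_; -[1+_]; _⊖_; sign; ∣_∣; _◃_)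
import Data.Integer.Properties as ℤP
open import Data.Sign as Sign using (Sign)
open import Data.Maybe using (just; nothing)
open import Data.Fin using (Fin)
open import Data.Vec using ([]; _∷_)
open import Relation.Nullary using (¬_; yes; no)
open import Relation.Binary.Definitions using (WeaklyDecidable)
import Relation.Binary.PropositionalEquality as PE
open import Algebra.Bundles using (CommutativeRing)
open import Algebra.Solver.Ring.AlmostCommutativeRing
  using (_-Raw-AlmostCommutative⟶_; fromCommutativeRing)

module IntegerCoefficients {r ℓ} (R : CommutativeRing r ℓ) where
  open CommutativeRing R
  open import Algebra.Properties.Ring ring
  open import Algebra.Properties.Semiring.Mult semiring using (_×_; ×-homo-+; ×1-homo-*)
  open import Relation.Binary.Reasoning.Setoid setoid

  private
    ι : ℕ → Carrier
    ι = ιᴿ R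

  ι≈×1 : ∀ n → ι n ≈ n × 1#
  ι≈×1 zero    = refl
  ι≈×1 (suc n) = +-cong refl (ι≈×1 n)

  ι-+ : ∀ m n → ι (m ℕ.+ n) ≈ ι m + ι n
  ι-+ m n = begin
    ι (m ℕ.+ n)           ≈⟨ ι≈×1 (m ℕ.+ n) ⟩
    (m ℕ.+ n) × 1#        ≈⟨ ×-homo-+ 1# m n ⟩
    m × 1# + n × 1#       ≈⟨ +-cong (ι≈×1 m) (ι≈×1 n) ⟨
    ι m + ι n             ∎

  ι-* : ∀ m n → ι (m ℕ.* n) ≈ ι m * ι n
  ι-* m n = begin
    ι (m ℕ.* n)           ≈⟨ ι≈×1 (m ℕ.* n) ⟩
    (m ℕ.* n) × 1#        ≈⟨ ×1-homo-* m n ⟩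
    (m × 1#) * (n × 1#)   ≈⟨ *-cong (ι≈×1 m) (ι≈×1 n) ⟨
    ι m * ι n             ∎

  ιℤ : ℤ → Carrier
  ιℤ (+ n)    = ι n
  ιℤ -[1+ n ] = - ι (suc n)

  1+-cancel : ∀ a b → (1# + a) - (1# + b) ≈ a - b
  1+-cancel a b = begin
    (1# + a) + - (1# + b)     ≈⟨ +-cong (+-comm a 1#) (-‿+-comm 1# b) ⟨
    (a + 1#) + (- 1# + - b)   ≈⟨ +-assoc a 1# _ ⟩
    a + (1# + (- 1# + - b))   ≈⟨ +-cong refl (+-assoc 1# (- 1#) (- b)) ⟨
    a + ((1# + - 1#) + - b)   ≈⟨ +-cong refl (+-cong (-‿inverseʳ 1#) refl) ⟩
    a + (0# + - b)            ≈⟨ +-cong refl (+-identityˡ _) ⟩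
    a + - b                   ∎

  ιℤ-⊖ : ∀ m n → ιℤ (m ⊖ n) ≈ ι m - ι n
  ιℤ-⊖ m zero rewrite ℤP.⊖-≥ {m} {0} ℕ.z≤n =
    sym (trans (+-cong refl -0#≈0#) (+-identityʳ _))
  ιℤ-⊖ zero (suc n) rewrite ℤP.⊖-< {0} {suc n} (ℕ.s≤s ℕ.z≤n) = sym (+-identityˡ _)
  ιℤ-⊖ (suc m) (suc n) rewrite ℤP.[1+m]⊖[1+n]≡m⊖n m n =
    trans (ιℤ-⊖ m n) (sym (1+-cancel (ι m) (ι n)))

  ιℤ-+ : ∀ i j → ιℤ (i ℤ.+ j) ≈ ιℤ i + ιℤ j
  ιℤ-+ -[1+ m ] -[1+ n ] = begin
    - (1# + ι (suc (m ℕ.+ n)))  ≈⟨ -‿cong (PE.subst (λ k → ι (suc k) ≈ ι (suc m) + ι (suc n))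
                                      (ℕP.+-suc m n) (ι-+ (suc m) (suc n))) ⟩
    - (ι (suc m) + ι (suc n))   ≈⟨ -‿+-comm _ _ ⟨
    - ι (suc m) + - ι (suc n)   ∎
  ιℤ-+ -[1+ m ] (+ n)    = trans (ιℤ-⊖ n (suc m)) (+-comm _ _)
  ιℤ-+ (+ m)    -[1+ n ] = ιℤ-⊖ m (suc n)
  ιℤ-+ (+ m)    (+ n)    = ι-+ m n

  ιℤ-neg : ∀ i → ιℤ (ℤ.- i) ≈ - ιℤ i
  ιℤ-neg -[1+ n ]    = sym (-‿involutive _)
  ιℤ-neg (+ zero)    = sym -0#≈0#
  ιℤ-neg (+ suc n)   = refl

  -- Multiplicativity goes through the sign–magnitude decomposition i = sign i ◃ ∣ i ∣.
  signed : Sign → Carrier → Carrier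
  signed Sign.+ v = v
  signed Sign.- v = - v

  signed-cong : ∀ s {v w} → v ≈ w → signed s v ≈ signed s w
  signed-cong Sign.+ p = p
  signed-cong Sign.- p = -‿cong p

  signed-* : ∀ s t v w → signed (s Sign.* t) (v * w) ≈ signed s v * signed t w
  signed-* Sign.+ Sign.+ v w = refl
  signed-* Sign.+ Sign.- v w = -‿distribʳ-* v w
  signed-* Sign.- Sign.+ v w = -‿distribˡ-* v w
  signed-* Sign.- Sign.- v w = begin
    v * w             ≈⟨ -‿involutive _ ⟨
    - (- (v * w))     ≈⟨ -‿cong (-‿distribʳ-* v w) ⟩
    - (v * - w)       ≈⟨ -‿distribˡ-* v (- w) ⟩
    - v * - w         ∎

  ιℤ-◃ : ∀ s n → ιℤ (s ◃ n) ≈ signed s (ι n)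
  ιℤ-◃ Sign.+ zero    = refl
  ιℤ-◃ Sign.- zero    = sym -0#≈0#
  ιℤ-◃ Sign.+ (suc n) = refl
  ιℤ-◃ Sign.- (suc n) = refl

  ιℤ-sign-abs : ∀ i → ιℤ i ≈ signed (sign i) (ι ∣ i ∣)
  ιℤ-sign-abs (+ n)    = refl
  ιℤ-sign-abs -[1+ n ] = refl

  ιℤ-* : ∀ i j → ιℤ (i ℤ.* j) ≈ ιℤ i * ιℤ j
  ιℤ-* i j = begin
    ιℤ (i ℤ.* j)                                ≈⟨ ιℤ-◃ s (∣ i ∣ ℕ.* ∣ j ∣) ⟩
    signed s (ι (∣ i ∣ ℕ.* ∣ j ∣))              ≈⟨ signed-cong s (ι-* ∣ i ∣ ∣ j ∣) ⟩
    signed s (ι ∣ i ∣ * ι ∣ j ∣)                ≈⟨ signed-* (sign i) (sign j) _ _ ⟩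
    signed (sign i) (ι ∣ i ∣) * signed (sign j) (ι ∣ j ∣)
                                                ≈⟨ *-cong (ιℤ-sign-abs i) (ιℤ-sign-abs j) ⟨
    ιℤ i * ιℤ j                                 ∎
    where
    s : Sign
    s = sign i Sign.* sign j

  -- How the solver reads integer constants: like ιℤ, except that 1 denotes 1# itself,
  -- so that the polynomial 1 + N evaluated at N = ι n is literally ι (suc n).
  coeff : ℤ → Carrier
  coeff (+ 1) = 1#
  coeff i     = ιℤ i

  coeff≈ιℤ : ∀ i → coeff i ≈ ιℤ i
  coeff≈ιℤ (+ zero)          = refl
  coeff≈ιℤ (+ suc zero)      = sym (+-identityʳ 1#)
  coeff≈ιℤ (+ suc (suc n))   = refl
  coeff≈ιℤ -[1+ n ]          = refl

  ℤ-morphism : ℤ.+-*-rawRing -Raw-AlmostCommutative⟶ fromCommutativeRing R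
  ℤ-morphism = record
    { ⟦_⟧    = coeff
    ; +-homo = λ i j → homo (ℤ._+_ i j) (ιℤ-+ i j) (+-cong (coeff≈ιℤ i) (coeff≈ιℤ j))
    ; *-homo = λ i j → homo (ℤ._*_ i j) (ιℤ-* i j) (*-cong (coeff≈ιℤ i) (coeff≈ιℤ j))
    ; -‿homo = λ i → homo (ℤ.- i) (ιℤ-neg i) (-‿cong (coeff≈ιℤ i))
    ; 0-homo = refl
    ; 1-homo = refl
    }
    where
    homo : ∀ k {v w} → ιℤ k ≈ v → w ≈ v → coeff k ≈ w
    homo k p q = trans (coeff≈ιℤ k) (trans p (sym q))

  coeff≟ : WeaklyDecidable (λ i j → coeff i ≈ coeff j)
  coeff≟ i j with i ℤ.≟ j
  ... | yes PE.refl = just refl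
  ... | no _        = nothing

  open import Algebra.Solver.Ring ℤ.+-*-rawRing (fromCommutativeRing R) ℤ-morphism coeff≟ public

module FieldLemmas {f ℓ} (F : CharZeroField f ℓ) where
  open CharZeroField F
  open IntegerCoefficients commRing using (ι-*)
  open import Relation.Binary.Reasoning.Setoid setoid

  telescope : ∀ (f G : ℕ → Carrier) N → G 0 ≈ 0# →
              (∀ n → suc n ℕ.≤ N → G (suc n) ≈ G n + f (suc n)) →
              Σ₁ N f ≈ G N
  telescope f G zero    G0 step = sym G0
  telescope f G (suc N) G0 step =
    trans (+-cong (telescope f G N G0 (λ n lt → step n (ℕP.m≤n⇒m≤1+n lt))) refl)
          (sym (step N ℕP.≤-refl))

  inverse-rescale : ∀ p q → ¬ p ≈ 0# → ¬ p * q ≈ 0# → p ⁻¹ ≈ q * (p * q) ⁻¹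
  inverse-rescale p q p≉0 pq≉0 = begin
    p ⁻¹                           ≈⟨ *-identityʳ _ ⟨
    p ⁻¹ * 1#                      ≈⟨ *-cong refl (inverseʳ (p * q) pq≉0) ⟨
    p ⁻¹ * ((p * q) * r)           ≈⟨ *-cong refl (*-assoc p q r) ⟩
    p ⁻¹ * (p * (q * r))           ≈⟨ *-assoc (p ⁻¹) p (q * r) ⟨
    (p ⁻¹ * p) * (q * r)           ≈⟨ *-cong (trans (*-comm _ _) (inverseʳ p p≉0)) refl ⟩
    1# * (q * r)                   ≈⟨ *-identityˡ _ ⟩
    q * r                          ∎
    where
    r : Carrier
    r = (p * q) ⁻¹

  ι-inverse-rescale : ∀ p q → ι (suc p) ⁻¹ ≈ ι (suc q) * ι (suc p ℕ.* suc q) ⁻¹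
  ι-inverse-rescale p q =
    trans (inverse-rescale (ι (suc p)) (ι (suc q)) (char0 p) product≉0)
          (*-cong refl (⁻¹-cong (sym (ι-* (suc p) (suc q)))))
    where
    product≉0 : ¬ ι (suc p) * ι (suc q) ≈ 0#
    product≉0 eq = char0 (q ℕ.+ p ℕ.* suc q) (trans (ι-* (suc p) (suc q)) eq)

module ClosedForm {f ℓ} (F : CharZeroField f ℓ) where
  open CharZeroField F
  open IntegerCoefficients commRing
  open FieldLemmas F using (ι-inverse-rescale)
  open import Relation.Binary.Reasoning.Setoid setoid

  κ : ∀ {m} → ℕ → Polynomial m
  κ n = con (+ n)

  -- The numerators A, B, C of the closed form (over 30, 1800 and 60) and the quotient
  -- Q = A / (x + N + 1), as polynomial expressions in x and N.
  Aₚ Cₚ Qₚ : ∀ {m} → Polynomial m → Polynomial m → Polynomial m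
  Aₚ x N = κ 6 :* x :^ 5 :+ κ 15 :* x :^ 4 :+ κ 10 :* x :^ 3 :- x :- N
           :+ κ 10 :* N :^ 3 :+ κ 15 :* N :^ 4 :+ κ 6 :* N :^ 5
  Cₚ x N = (κ 12 :* x :^ 3 :+ κ 24 :* x :^ 2 :+ κ 7 :* x :- κ 6 :* N :* x :^ 2 :- κ 9 :* N :* x
            :+ κ 4 :* N :^ 2 :* x :- κ 5 :+ κ 2 :* N :+ κ 4 :* N :^ 2 :- κ 3 :* N :^ 3) :* N :* x
  Qₚ x N = κ 6 :* x :^ 4 :+ κ 9 :* x :^ 3 :- κ 6 :* x :^ 3 :* N :+ x :^ 2 :- κ 3 :* x :^ 2 :* N
           :+ κ 6 :* x :^ 2 :* N :^ 2 :- x :+ κ 2 :* x :* N :- κ 3 :* x :* N :^ 2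
           :- κ 6 :* x :* N :^ 3 :- N :+ N :^ 2 :+ κ 9 :* N :^ 3 :+ κ 6 :* N :^ 4

  Bₚ : ∀ {m} → Polynomial m → Polynomial m
  Bₚ N = (κ 72 :* N :^ 4 :- κ 45 :* N :^ 3 :- κ 130 :* N :^ 2 :+ κ 75 :* N :+ κ 28) :* N

  A C Q : Carrier → Carrier → Carrier
  A x N = ⟦ Aₚ (var Fin.zero) (var (Fin.suc Fin.zero)) ⟧ (x ∷ N ∷ [])
  C x N = ⟦ Cₚ (var Fin.zero) (var (Fin.suc Fin.zero)) ⟧ (x ∷ N ∷ [])
  Q x N = ⟦ Qₚ (var Fin.zero) (var (Fin.suc Fin.zero)) ⟧ (x ∷ N ∷ [])

  B : Carrier → Carrier
  B N = ⟦ Bₚ (var Fin.zero) ⟧ (N ∷ [])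

  closedForm : Carrier → Carrier → Carrier → Carrier
  closedForm x N h = ((A x N * ι 30 ⁻¹) * h - B N * ι 1800 ⁻¹) - C x N * ι 60 ⁻¹

  -- (i) A/30 is a shifted power sum: its forward difference is (N+1)⁴.
  A-shift : ∀ x N → A x (1# + N) ≈ A x N + ι 30 * (1# + N) ^ 4
  A-shift = solve 2 (λ x N → Aₚ x (κ 1 :+ N) := Aₚ x N :+ κ 30 :* (κ 1 :+ N) :^ 4) refl

  A-factor : ∀ x N → A x N ≈ (x + (1# + N)) * Q x N
  A-factor = solve 2 (λ x N → Aₚ x N := (x :+ (κ 1 :+ N)) :* Qₚ x N) refl

  ΔB : Carrier → Carrier
  ΔB N = B (1# + N) - B N

  ΔC : Carrier → Carrier → Carrier
  ΔC x N = C x (1# + N) - C x N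

  BC-shift : ∀ x N → ΔB N + ι 30 * ΔC x N ≈ ι 60 * Q x N
  BC-shift = solve 2 (λ x N → (Bₚ (κ 1 :+ N) :- Bₚ N) :+ κ 30 :* (Cₚ x (κ 1 :+ N) :- Cₚ x N)
                              := κ 60 :* Qₚ x N) refl

  -- By (ii), (iii) and 1/30 = 60/1800, 1/60 = 30/1800: if u = 1/(x+N+1), the term
  -- A(x,N)/30 · u is exactly the growth ΔB/1800 + ΔC/60 of the polynomial part.
  extra-term : ∀ x N u → (x + (1# + N)) * u ≈ 1# →
    (A x N * ι 30 ⁻¹) * u ≈ ΔB N * ι 1800 ⁻¹ + ΔC x N * ι 60 ⁻¹
  extra-term x N u inv = begin
    (A x N * a) * u                     ≈⟨ *-cong (*-cong (A-factor x N) refl) refl ⟩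
    ((d * Q x N) * a) * u               ≈⟨ reorder d (Q x N) a u ⟩
    (d * u) * (Q x N * a)               ≈⟨ *-cong inv refl ⟩
    1# * (Q x N * a)                    ≈⟨ *-identityˡ _ ⟩
    Q x N * a                           ≈⟨ *-cong refl (ι-inverse-rescale 29 59) ⟩
    Q x N * (ι 60 * b)                  ≈⟨ pull (Q x N) (ι 60) b ⟩
    (ι 60 * Q x N) * b                  ≈⟨ *-cong (BC-shift x N) refl ⟨
    (ΔB N + ι 30 * ΔC x N) * b          ≈⟨ split (ΔB N) (ΔC x N) (ι 30) b ⟩
    ΔB N * b + ΔC x N * (ι 30 * b)      ≈⟨ +-cong refl (*-cong refl (ι-inverse-rescale 59 29)) ⟨
    ΔB N * b + ΔC x N * ι 60 ⁻¹         ∎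
    where
    a b d : Carrier
    a = ι 30 ⁻¹
    b = ι 1800 ⁻¹
    d = x + (1# + N)
    reorder : ∀ p q r s → ((p * q) * r) * s ≈ (p * s) * (q * r)
    reorder = solve 4 (λ p q r s → ((p :* q) :* r) :* s := (p :* s) :* (q :* r)) refl
    pull : ∀ p q r → p * (q * r) ≈ (q * p) * r
    pull = solve 3 (λ p q r → p :* (q :* r) := (q :* p) :* r) refl
    split : ∀ p q r s → (p + r * q) * s ≈ p * s + q * (r * s)
    split = solve 4 (λ p q r s → (p :+ r :* q) :* s := p :* s :+ q :* (r :* s)) refl

  -- F(0, 0) = 0: every term carries a factor h or N.
  closedForm-zero : ∀ x → closedForm x 0# 0# ≈ 0#
  closedForm-zero x = begin
    ((A x 0# * a) * 0# - B 0# * b) - C x 0# * c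
      ≈⟨ +-cong (+-cong (zeroʳ _) (-‿cong (*-cong (zeroʳ _) refl)))
                (-‿cong (*-cong (trans (*-cong (zeroʳ _) refl) (zeroˡ _)) refl)) ⟩
    (0# - 0# * b) - 0# * c
      ≈⟨ solve 2 (λ b c → (κ 0 :- κ 0 :* b) :- κ 0 :* c := κ 0) refl b c ⟩
    0# ∎
    where
    a b c : Carrier
    a = ι 30 ⁻¹
    b = ι 1800 ⁻¹
    c = ι 60 ⁻¹

  closedForm-step : ∀ x N h u → (x + (1# + N)) * u ≈ 1# →
    closedForm x (1# + N) (h + u) ≈ closedForm x N h + (1# + N) ^ 4 * (h + u)
  closedForm-step x N h u inv = begin
    closedForm x (1# + N) (h + u)
      ≈⟨ +-cong (+-cong (*-cong (*-cong (A-shift x N) refl) refl) refl) refl ⟩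
    (((A x N + ι 30 * P) * a) * (h + u) - B (1# + N) * b) - C x (1# + N) * c
      ≈⟨ regroup (A x N) P a h u (B N) (B (1# + N)) b (C x N) (C x (1# + N)) c ⟩
    closedForm x N h + (ι 30 * a) * (P * (h + u))
      + ((A x N * a) * u - (ΔB N * b + ΔC x N * c))
      ≈⟨ +-cong (+-cong refl (*-cong (inverseʳ (ι 30) (char0 29)) refl))
                (trans (+-cong (extra-term x N u inv) refl) (-‿inverseʳ _)) ⟩
    closedForm x N h + 1# * (P * (h + u)) + 0#
      ≈⟨ trans (+-identityʳ _) (+-cong refl (*-identityˡ _)) ⟩
    closedForm x N h + P * (h + u) ∎
    where
    a b c P : Carrier
    a = ι 30 ⁻¹
    b = ι 1800 ⁻¹
    c = ι 60 ⁻¹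
    P = (1# + N) ^ 4
    -- separate the old closed form, the new summand and the extra term
    regroup : ∀ A₀ P a h u B₀ B₁ b C₀ C₁ c →
      (((A₀ + ι 30 * P) * a) * (h + u) - B₁ * b) - C₁ * c
      ≈ (((A₀ * a) * h - B₀ * b) - C₀ * c) + (ι 30 * a) * (P * (h + u))
        + ((A₀ * a) * u - ((B₁ - B₀) * b + (C₁ - C₀) * c))
    regroup = solve 11 (λ A₀ P a h u B₀ B₁ b C₀ C₁ c →
      (((A₀ :+ κ 30 :* P) :* a) :* (h :+ u) :- B₁ :* b) :- C₁ :* c
      := (((A₀ :* a) :* h :- B₀ :* b) :- C₀ :* c) :+ (κ 30 :* a) :* (P :* (h :+ u))
         :+ ((A₀ :* a) :* u :- ((B₁ :- B₀) :* b :+ (C₁ :- C₀) :* c))) refl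

proposition21 : ∀ {c ℓ} (F : CharZeroField c ℓ) → let open CharZeroField F in
    ∀ (x : Carrier) (n : ℕ) → Admissible n x →
      Σ₁ n (λ k → (ι k ^ 4) * H k x)
      ≈ (((ι 6 * x ^ 5 + ι 15 * x ^ 4 + ι 10 * x ^ 3 - x - ι n
            + ι 10 * ι n ^ 3 + ι 15 * ι n ^ 4 + ι 6 * ι n ^ 5) * ι 30 ⁻¹) * H n x
        - ((ι 72 * ι n ^ 4 - ι 45 * ι n ^ 3 - ι 130 * ι n ^ 2 + ι 75 * ι n + ι 28) * ι n) * ι 1800 ⁻¹)
        - ((ι 12 * x ^ 3 + ι 24 * x ^ 2 + ι 7 * x - ι 6 * ι n * x ^ 2 - ι 9 * ι n * x
            + ι 4 * ι n ^ 2 * x - ι 5 + ι 2 * ι n + ι 4 * ι n ^ 2 - ι 3 * ι n ^ 3) * ι n * x) * ι 60 ⁻¹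
proposition21 F x n adm =
  telescope (λ k → ι k ^ 4 * H k x) (λ k → closedForm x (ι k) (H k x)) n
            (closedForm-zero x) step
  where
  open CharZeroField F
  open FieldLemmas F using (telescope)
  open ClosedForm F using (closedForm; closedForm-zero; closedForm-step)

  -- H_{k+1}(x) = H_k(x) + 1/(x+k+1), and x + (k+1) is invertible for k < n
  step : ∀ k → suc k ℕ.≤ n →
         closedForm x (ι (suc k)) (H (suc k) x)
         ≈ closedForm x (ι k) (H k x) + ι (suc k) ^ 4 * H (suc k) x
  step k k<n = closedForm-step x (ι k) (H k x) ((x + ι (suc k)) ⁻¹)
                 (inverseʳ _ (adm (suc k) (ℕ.s≤s ℕ.z≤n) k<n))
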